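{- Let $a,b,c>1$ be integers with $\gcd(a,b)>1$ and let $p\in Q$. Then the equation $a^x+b^y=c^z$ has at most one solution in positive integers $(x,y,z)$ which is Type O for $p$.
   Context: $Q$ is the set of primes dividing all of $a$, $b$, $c$. For $p\in Q$ let $p^{\alpha_p}\parallel a$, $p^{\beta_p}\parallel b$, $p^{\gamma_p}\parallel c$. A solution $(x,y,z)$ is Type O for $p$ if $\alpha_px=\beta_py=\gamma_pz$. -}

module Defs where

open import Data.Nat using (ℕ; suc; _*_; _^_; _<_)
open import Data.Nat.Divisibility using (_∣_)
open import Data.Nat.Primality using (Prime)
open import Data.Product using (_×_)
open import Relation.Nullary using (¬_)
open import Relation.Binary.PropositionalEquality using (_≡_)

_^_∥_ : ℕ → ℕ → ℕ → Set
p ^ k ∥ n = (p ^ k ∣ n) × ¬ (p ^ suc k ∣ n)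

InQ : ℕ → ℕ → ℕ → ℕ → Set
InQ a b c p = Prime p × (p ∣ a) × (p ∣ b) × (p ∣ c)

IsSolution : ℕ → ℕ → ℕ → ℕ → ℕ → ℕ → Set
IsSolution a b c x y z = (0 < x) × (0 < y) × (0 < z) × (a ^ x Data.Nat.+ b ^ y ≡ c ^ z)

TypeO : ℕ → ℕ → ℕ → ℕ → ℕ → ℕ → ℕ → Set
TypeO a b c p x y z =
  ∀ α β γ → p ^ α ∥ a → p ^ β ∥ b → p ^ γ ∥ c →
  (α * x ≡ β * y) × (β * y ≡ γ * z)

{-# OPTIONS --safe #-}
module Submission where

-- Let p ^ α ∥ a, p ^ β ∥ b, p ^ γ ∥ c; then α, β, γ > 0 because p divides a, b and c.
-- Type O solutions have αx = βy = γz, so if (x, y, z) and (x′, y′, z′) are two of them with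
-- x < x′, then the increments (u, v, w) = (x′ - x, y′ - y, z′ - z) are positive and proportional
-- to (x, y, z). Hence a ^ x < c ^ z rescales to a ^ u < c ^ w, likewise b ^ v < c ^ w, and
-- a ^ x′ + b ^ y′ = a ^ x a ^ u + b ^ y b ^ v < (a ^ x + b ^ y) c ^ w = c ^ z′.

open import Defs
open import Data.Nat using (ℕ; _<_; suc; _+_; _*_; _^_; _≤_; z<s; NonZero; >-nonZero; nonTrivial⇒n>1)
open import Data.Nat.GCD using (gcd)
open import Data.Nat.Properties
open import Data.Nat.Induction using (<-rec)
open import Data.Nat.Divisibility using (_∣_; divides-refl; _∣?_; 1∣_; *-monoˡ-∣; *-cancelʳ-∣)
open import Data.Nat.Primality using (prime⇒nonTrivial)
open import Data.Product using (_×_; _,_; ∃-syntax)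
open import Data.Empty using (⊥-elim)
open import Function using (_∘_)
open import Relation.Nullary using (¬_; yes; no)
open import Relation.Binary.PropositionalEquality
open import Algebra.Properties.CommutativeSemigroup *-commutativeSemigroup
  using (x∙yz≈y∙xz; xy∙z≈y∙xz)

∃-exact-power : ∀ {p} → 1 < p → ∀ n → 0 < n → ∃[ k ] p ^ k ∥ n
∃-exact-power {p} 1<p = <-rec (λ n → 0 < n → ∃[ k ] p ^ k ∥ n) step
  where
  instance
    p≢0 : NonZero p
    p≢0 = >-nonZero (<-trans z<s 1<p)

  step : ∀ n → (∀ {m} → m < n → 0 < m → ∃[ k ] p ^ k ∥ m) → 0 < n → ∃[ k ] p ^ k ∥ n
  step n rec n>0 with p ∣? n
  ... | no p∤n = 0 , 1∣ n , p∤n ∘ subst (_∣ n) (^-identityʳ p)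
  ... | yes (divides-refl 0) = ⊥-elim (<-irrefl refl n>0)
  ... | yes (divides-refl m@(suc _)) =
    let k , p^k∣m , p^1+k∤m = rec (m<m*n m p 1<p) z<s
    in suc k
     , subst (_∣ m * p) (*-comm (p ^ k) p) (*-monoˡ-∣ p p^k∣m)
     , p^1+k∤m ∘ *-cancelʳ-∣ p ∘ subst (_∣ m * p) (*-comm p (p ^ suc k))

∥-exponent>0 : ∀ {p k n} → p ∣ n → p ^ k ∥ n → 0 < k
∥-exponent>0 {p} {0} {n} p∣n (_ , p^1∤n) =
  ⊥-elim (p^1∤n (subst (_∣ n) (sym (^-identityʳ p)) p∣n))
∥-exponent>0 {k = suc _} _ _ = z<s

m<n⇒∃[o]m+[1+o]≡n : ∀ {m n} → m < n → ∃[ o ] m + suc o ≡ n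
m<n⇒∃[o]m+[1+o]≡n {m} m<n =
  let o , 1+m+o≡n = m≤n⇒∃[o]m+o≡n m<n in o , trans (+-suc m o) 1+m+o≡n

proportional-< : ∀ {m} n {x y x′ y′} → 0 < m →
  m * x ≡ n * y → m * x′ ≡ n * y′ → x < x′ → y < y′
proportional-< {m} n {y = y} {y′ = y′} m>0 mx≡ny mx′≡ny′ x<x′ =
  *-cancelˡ-< n y y′ (subst₂ _<_ mx≡ny mx′≡ny′ (*-monoʳ-< m {{>-nonZero m>0}} x<x′))

proportional-increments : ∀ {m} n {x z u w} → 0 < m →
  m * x ≡ n * z → m * (x + u) ≡ n * (z + w) → x * w ≡ z * u
proportional-increments {m} n {x} {z} {u} {w} m>0 mx≡nz m[x+u]≡n[z+w] =
  *-cancelˡ-≡ (x * w) (z * u) m {{>-nonZero m>0}} (begin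
    m * (x * w) ≡⟨ sym (*-assoc m x w) ⟩
    m * x * w   ≡⟨ cong (_* w) mx≡nz ⟩
    n * z * w   ≡⟨ xy∙z≈y∙xz n z w ⟩
    z * (n * w) ≡⟨ cong (z *_) (sym mu≡nw) ⟩
    z * (m * u) ≡⟨ x∙yz≈y∙xz z m u ⟩
    m * (z * u) ∎)
  where
  open ≡-Reasoning
  mu≡nw : m * u ≡ n * w
  mu≡nw = +-cancelˡ-≡ (m * x) (m * u) (n * w) (begin
    m * x + m * u ≡⟨ sym (*-distribˡ-+ m x u) ⟩
    m * (x + u)   ≡⟨ m[x+u]≡n[z+w] ⟩
    n * (z + w)   ≡⟨ *-distribˡ-+ n z w ⟩
    n * z + n * w ≡⟨ cong (_+ n * w) (sym mx≡nz) ⟩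
    m * x + n * w ∎)

m^o<n^o⇒m<n : ∀ {m n} o → m ^ o < n ^ o → m < n
m^o<n^o⇒m<n o mᵒ<nᵒ = ≰⇒> (<⇒≱ mᵒ<nᵒ ∘ ^-monoˡ-≤ o)

-- a ^ x < c ^ z says x log a < z log c, which survives scaling by u / x = w / z.
^-<-rescale : ∀ {a c x z u w} → 0 < u → x * w ≡ z * u → a ^ x < c ^ z → a ^ u < c ^ w
^-<-rescale {a} {c} {x} {z} {u} {w} u>0 xw≡zu aˣ<cᶻ = m^o<n^o⇒m<n x (begin-strict
  (a ^ u) ^ x ≡⟨ ^-*-assoc a u x ⟩
  a ^ (u * x) ≡⟨ cong (a ^_) (*-comm u x) ⟩
  a ^ (x * u) ≡⟨ sym (^-*-assoc a x u) ⟩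
  (a ^ x) ^ u <⟨ ^-monoˡ-< u {{>-nonZero u>0}} aˣ<cᶻ ⟩
  (c ^ z) ^ u ≡⟨ ^-*-assoc c z u ⟩
  c ^ (z * u) ≡⟨ cong (c ^_) (trans (sym xw≡zu) (*-comm x w)) ⟩
  c ^ (w * x) ≡⟨ sym (^-*-assoc c w x) ⟩
  (c ^ w) ^ x ∎)
  where open ≤-Reasoning

^+^-extend-< : ∀ {a b c x y z u v w} → 0 < a →
  a ^ x + b ^ y ≡ c ^ z → a ^ u < c ^ w → b ^ v ≤ c ^ w →
  a ^ (x + u) + b ^ (y + v) < c ^ (z + w)
^+^-extend-< {a} {b} {c} {x} {y} {z} {u} {v} {w} a>0 sol aᵘ<cʷ bᵛ≤cʷ = begin-strict
  a ^ (x + u) + b ^ (y + v)       ≡⟨ cong₂ _+_ (^-distribˡ-+-* a x u) (^-distribˡ-+-* b y v) ⟩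
  a ^ x * a ^ u + b ^ y * b ^ v   <⟨ +-mono-<-≤ (*-monoʳ-< (a ^ x) {{aˣ≢0}} aᵘ<cʷ)
                                                (*-monoʳ-≤ (b ^ y) bᵛ≤cʷ) ⟩
  a ^ x * c ^ w + b ^ y * c ^ w   ≡⟨ sym (*-distribʳ-+ (c ^ w) (a ^ x) (b ^ y)) ⟩
  (a ^ x + b ^ y) * c ^ w         ≡⟨ cong (_* c ^ w) sol ⟩
  c ^ z * c ^ w                   ≡⟨ sym (^-distribˡ-+-* c z w) ⟩
  c ^ (z + w)                     ∎
  where
  open ≤-Reasoning
  aˣ≢0 : NonZero (a ^ x)
  aˣ≢0 = m^n≢0 a x {{>-nonZero a>0}}

module _ {a b c α β γ : ℕ} (a>0 : 0 < a) (b>0 : 0 < b)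
         (α>0 : 0 < α) (β>0 : 0 < β) (γ>0 : 0 < γ) where

  no-proportional-extension : ∀ {x y z u v w} →
    a ^ x + b ^ y ≡ c ^ z → α * x ≡ γ * z → β * y ≡ γ * z →
    α * (x + suc u) ≡ γ * (z + w) → β * (y + suc v) ≡ γ * (z + w) →
    a ^ (x + suc u) + b ^ (y + suc v) ≢ c ^ (z + w)
  no-proportional-extension {x} {y} {z} {u} {v} {w} sol αx≡γz βy≡γz αx′≡γz′ βy′≡γz′ sol′ =
    <-irrefl sol′ (^+^-extend-< {x = x} {y} {z} {suc u} {suc v} {w} a>0 sol aᵘ<cʷ (<⇒≤ bᵛ<cʷ))
    where
    aˣ<cᶻ : a ^ x < c ^ z
    aˣ<cᶻ = subst (a ^ x <_) sol (m<m+n (a ^ x) (m^n>0 b {{>-nonZero b>0}} y))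
    bʸ<cᶻ : b ^ y < c ^ z
    bʸ<cᶻ = subst (b ^ y <_) sol (m<n+m (b ^ y) (m^n>0 a {{>-nonZero a>0}} x))
    aᵘ<cʷ : a ^ suc u < c ^ w
    aᵘ<cʷ = ^-<-rescale {x = x} {z} {suc u} {w} z<s
              (proportional-increments γ α>0 αx≡γz αx′≡γz′) aˣ<cᶻ
    bᵛ<cʷ : b ^ suc v < c ^ w
    bᵛ<cʷ = ^-<-rescale {x = y} {z} {suc v} {w} z<s
              (proportional-increments γ β>0 βy≡γz βy′≡γz′) bʸ<cᶻ

  proportional-solution-≮ : ∀ {x y z x′ y′ z′} →
    a ^ x + b ^ y ≡ c ^ z → α * x ≡ γ * z → β * y ≡ γ * z →
    a ^ x′ + b ^ y′ ≡ c ^ z′ → α * x′ ≡ γ * z′ → β * y′ ≡ γ * z′ →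
    ¬ x < x′
  proportional-solution-≮ {y = y} {z} {y′ = y′} {z′}
    sol αx≡γz βy≡γz sol′ αx′≡γz′ βy′≡γz′ x<x′
    with m<n⇒∃[o]m+[1+o]≡n x<x′ | m<n⇒∃[o]m+[1+o]≡n y<y′
       | m≤n⇒∃[o]m+o≡n (<⇒≤ z<z′)
    where
    z<z′ : z < z′
    z<z′ = proportional-< γ α>0 αx≡γz αx′≡γz′ x<x′
    y<y′ : y < y′
    y<y′ = proportional-< β γ>0 (sym βy≡γz) (sym βy′≡γz′) z<z′
  ... | _ , refl | _ , refl | _ , refl =
    no-proportional-extension sol αx≡γz βy≡γz αx′≡γz′ βy′≡γz′ sol′

  proportional-solutions-unique : ∀ {x y z x′ y′ z′} →
    a ^ x + b ^ y ≡ c ^ z → α * x ≡ γ * z → β * y ≡ γ * z →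
    a ^ x′ + b ^ y′ ≡ c ^ z′ → α * x′ ≡ γ * z′ → β * y′ ≡ γ * z′ →
    (x ≡ x′) × (y ≡ y′) × (z ≡ z′)
  proportional-solutions-unique {x} {y} {z} {x′} {y′} {z′}
    sol αx≡γz βy≡γz sol′ αx′≡γz′ βy′≡γz′ = x≡x′ , y≡y′ , z≡z′
    where
    x≡x′ : x ≡ x′
    x≡x′ = ≤-antisym
      (≮⇒≥ (proportional-solution-≮ sol′ αx′≡γz′ βy′≡γz′ sol αx≡γz βy≡γz))
      (≮⇒≥ (proportional-solution-≮ sol αx≡γz βy≡γz sol′ αx′≡γz′ βy′≡γz′))
    z≡z′ : z ≡ z′
    z≡z′ = *-cancelˡ-≡ z z′ γ {{>-nonZero γ>0}}
      (trans (sym αx≡γz) (trans (cong (α *_) x≡x′) αx′≡γz′))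
    y≡y′ : y ≡ y′
    y≡y′ = *-cancelˡ-≡ y y′ β {{>-nonZero β>0}}
      (trans βy≡γz (trans (cong (γ *_) z≡z′) (sym βy′≡γz′)))

proposition3p3 : (a b c p : ℕ) → 1 < a → 1 < b → 1 < c → 1 < gcd a b →
    InQ a b c p →
    (x y z x′ y′ z′ : ℕ) →
    IsSolution a b c x y z → TypeO a b c p x y z →
    IsSolution a b c x′ y′ z′ → TypeO a b c p x′ y′ z′ →
    (x ≡ x′) × (y ≡ y′) × (z ≡ z′)
proposition3p3 a b c p 1<a 1<b 1<c _ (p-prime , p∣a , p∣b , p∣c) x y z x′ y′ z′
  (_ , _ , _ , sol) typeO (_ , _ , _ , sol′) typeO′ =
  let α , α>0 , p^α∥a = positive-exact-power p∣a 1<a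
      β , β>0 , p^β∥b = positive-exact-power p∣b 1<b
      γ , γ>0 , p^γ∥c = positive-exact-power p∣c 1<c
      αx≡βy , βy≡γz = typeO α β γ p^α∥a p^β∥b p^γ∥c
      αx′≡βy′ , βy′≡γz′ = typeO′ α β γ p^α∥a p^β∥b p^γ∥c
  in proportional-solutions-unique {c = c} (<-trans z<s 1<a) (<-trans z<s 1<b) α>0 β>0 γ>0
       sol (trans αx≡βy βy≡γz) βy≡γz sol′ (trans αx′≡βy′ βy′≡γz′) βy′≡γz′
  where
  positive-exact-power : ∀ {n} → p ∣ n → 1 < n → ∃[ k ] 0 < k × p ^ k ∥ n
  positive-exact-power {n} p∣n 1<n =
    let k , p^k∥n = ∃-exact-power (nonTrivial⇒n>1 p {{prime⇒nonTrivial p-prime}}) n (<-trans z<s 1<n)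
    in k , ∥-exponent>0 p∣n p^k∥n , p^k∥n
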